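{- For the $k$-median cost of $(x',y')$ the following holds: \[\mathrm{cost}(x',y')\le 3\cdot\mathrm{cost}(x,y)+\mathrm{cost}(x^{\mathrm{DS}},y^{\mathrm{DS}}).\]
   Context: Let $(P,d)$ be a finite metric space, $k\in\{1,\dots,|P|\}$, $P=P_1\,\dot\cup\dots\dot\cup\,P_m$ a partition into color classes, $H=\{1,\dots,m\}$, with bounds $0\le\ell_h\le u_h\le1$. For a (fractional) solution, $\mathrm{cost}(x,y)=\sum_{i,j\in P}x_{ij}d(i,j)$. Let $(x,y)$ be an optimal solution of the LP: minimize $\sum_{i,j}x_{ij}d(i,j)$ subject to $\sum_{i}x_{ij}=1$ for all $j$; $x_{ij}\le y_i$; $\sum_iy_i\le k$; $\ell_h\sum_{j\in P}x_{ij}\le\sum_{j\in P_h}x_{ij}\le u_h\sum_{j\in P}x_{ij}$ for all $h,i$; $0\le x_{ij},y_i\le1$. Let $(\mathcal{C}_{\mathrm{DS}},\varphi)$ be the clustering returned by an approximation algorithm for $k$-median with diverse center selection ($\mathcal{C}_{\mathrm{DS}}\subseteq P$, $|\mathcal{C}_{\mathrm{DS}}|\le k$, $\varphi:P\to\mathcal{C}_{\mathrm{DS}}$), encoded as $y^{\mathrm{DS}}_i=1$ iff $i\in\mathcal{C}_{\mathrm{DS}}$ and $x^{\mathrm{DS}}_{ij}=1$ iff $\varphi(j)=i$ (else $0$). Let $N(i)=\{p\in P\mid x_{pi}>0\}$; $r^i_p=x_{pi}/\sum_{l\in P}x_{pl}$ if $x_{pi}>0$ and $r^i_p=0$ otherwise;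 $\theta$ maps each $p\in P$ with $y_p>0$ to some $\theta(p)\in\arg\min_{i\in\mathcal{C}_{\mathrm{DS}}}d(p,i)$. Then $(x',y')$ is defined by $y'_i=1$ if $i\in\mathcal{C}_{\mathrm{DS}}$ and $0$ otherwise; for $i\in\mathcal{C}_{\mathrm{DS}}$, $x'_{ij}=\sum_{p\in N(i)}r^i_px_{pj}+\sum_{p\in\theta^{ -1}(i)}\bigl(1-\sum_{l'\in\mathcal{C}_{\mathrm{DS}}}r^{l'}_p\bigr)x_{pj}$, and $x'_{ij}=0$ otherwise.
   Formalization: The distances d, the bounds $\ell_h$ and $u_h$, and the LP solution $(x,y)$ are rational, with optimality of $(x,y)$ taken among rational feasible solutions only. -}

module Defs where

open import Data.Nat using (ℕ; zero; suc)
open import Data.Fin using (Fin; zero; suc)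
open import Data.Bool using (Bool; true; false; if_then_else_)
open import Data.Product using (_×_; Σ; ∃)
open import Data.Integer using (+_)
open import Data.Rational using (ℚ; 0ℚ; 1ℚ; _+_; _*_; _-_; _≤_; _<_; 1/_; ≢-nonZero; _/_)
open import Data.Rational.Properties using (_≟_; _<?_)
open import Relation.Nullary using (yes; no; ¬_)
open import Relation.Nullary.Decidable using (⌊_⌋)
open import Relation.Binary.PropositionalEquality using (_≡_)
import Data.Fin.Properties as FinP
import Data.Nat

Σ[_] : ∀ {n} → (Fin n → ℚ) → ℚ
Σ[_] {zero}  f = 0ℚ
Σ[_] {suc n} f = f zero + Σ[_] {n} (λ i → f (suc i))

count : ∀ {n} → (Fin n → Bool) → ℕ
count {zero}  C = zero
count {suc n} C = (if C zero then 1 else 0) Data.Nat.+ count {n} (λ i → C (suc i))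

ℕ→ℚ : ℕ → ℚ
ℕ→ℚ k = (+ k) / 1

[_<ℚ_] : ℚ → ℚ → ℚ
[ a <ℚ b ] with a <? b
... | yes _ = 1ℚ
... | no  _ = 0ℚ

record IsMetric {n : ℕ} (d : Fin n → Fin n → ℚ) : Set where
  field
    nonneg    : ∀ i j → 0ℚ ≤ d i j
    zero-iff  : ∀ i j → (d i j ≡ 0ℚ → i ≡ j) × (i ≡ j → d i j ≡ 0ℚ)
    symmetric : ∀ i j → d i j ≡ d j i
    triangle  : ∀ i j l → d i l ≤ d i j + d j l

cost : ∀ {n} → (Fin n → Fin n → ℚ) → (Fin n → Fin n → ℚ) → (Fin n → ℚ) → ℚ
cost d x y = Σ[ (λ i → Σ[ (λ j → x i j * d i j) ]) ]

-- Feasibility for the fair k-median LP (colours col : Fin n → Fin m, P_h = col⁻¹(h)).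
record LPFeasible {n m : ℕ} (k : ℕ) (col : Fin n → Fin m) (ℓ u : Fin m → ℚ)
                  (x : Fin n → Fin n → ℚ) (y : Fin n → ℚ) : Set where
  field
    assign   : ∀ j → Σ[ (λ i → x i j) ] ≡ 1ℚ
    open≤y   : ∀ i j → x i j ≤ y i
    budget   : Σ[ y ] ≤ ℕ→ℚ k
    lower    : ∀ h i → ℓ h * Σ[ (λ j → x i j) ]
                        ≤ Σ[ (λ j → if ⌊ col j FinP.≟ h ⌋ then x i j else 0ℚ) ]
    upper    : ∀ h i → Σ[ (λ j → if ⌊ col j FinP.≟ h ⌋ then x i j else 0ℚ) ]
                        ≤ u h * Σ[ (λ j → x i j) ]
    x-bounds : ∀ i j → 0ℚ ≤ x i j × x i j ≤ 1ℚ
    y-bounds : ∀ i → 0ℚ ≤ y i × y i ≤ 1ℚ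

LPOptimal : {n m : ℕ} (k : ℕ) (col : Fin n → Fin m) (ℓ u : Fin m → ℚ)
            (d : Fin n → Fin n → ℚ) (x : Fin n → Fin n → ℚ) (y : Fin n → ℚ) → Set
LPOptimal k col ℓ u d x y =
  LPFeasible k col ℓ u x y ×
  (∀ x₂ y₂ → LPFeasible k col ℓ u x₂ y₂ → cost d x y ≤ cost d x₂ y₂)

-- Encoding of an integral clustering (C, φ): y^DS, x^DS.
yDS : ∀ {n} → (Fin n → Bool) → Fin n → ℚ
yDS C i = if C i then 1ℚ else 0ℚ

xDS : ∀ {n} → (Fin n → Fin n) → Fin n → Fin n → ℚ
xDS φ i j with φ j FinP.≟ i
... | yes _ = 1ℚ
... | no  _ = 0ℚ

r : ∀ {n} → (Fin n → Fin n → ℚ) → Fin n → Fin n → ℚ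
r x i p with 0ℚ <? x p i
... | no  _ = 0ℚ
... | yes _ with Σ[ (λ l → x p l) ] ≟ 0ℚ
...   | yes _ = 0ℚ   -- impossible case (the sum is ≥ x_pi > 0 for feasible x)
...   | no s≢0 = x p i * (1/ Σ[ (λ l → x p l) ]) {{≢-nonZero s≢0}}

-- indicator of p ∈ θ⁻¹(i), where θ is only defined on p with y_p > 0
inθ⁻¹ : ∀ {n} → (Fin n → ℚ) → (Fin n → Fin n) → Fin n → Fin n → ℚ
inθ⁻¹ y θ i p with 0ℚ <? y p | θ p FinP.≟ i
... | yes _ | yes _ = 1ℚ
... | _     | _     = 0ℚ

inN : ∀ {n} → (Fin n → Fin n → ℚ) → Fin n → Fin n → ℚ
inN x i p = [ 0ℚ <ℚ x p i ]

y′ : ∀ {n} → (Fin n → Bool) → Fin n → ℚ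
y′ C i = if C i then 1ℚ else 0ℚ

x′ : ∀ {n} → (Fin n → Bool) → (Fin n → Fin n) → (Fin n → Fin n → ℚ) → (Fin n → ℚ)
     → Fin n → Fin n → ℚ
x′ C θ x y i j =
  if C i
  then Σ[ (λ p → inN x i p * (r x i p * x p j)) ]
       + Σ[ (λ p → inθ⁻¹ y θ i p *
                   ((1ℚ - Σ[ (λ l′ → if C l′ then r x l′ p else 0ℚ) ]) * x p j)) ]
  else 0ℚ

{-# OPTIONS --safe #-}
module Submission where

-- Write x′ i j = Σ_p t i p · x p j, where t i p is the fraction of the load X_p = Σ_l x p l of the
-- LP centre p that is moved to the selected centre i: i receives r^i_p, and if y_p > 0 then θ(p) also
-- receives the remainder 1 − Σ_{i ∈ C} r^i_p.  These fractions are nonnegative and sum to at most 1,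
-- so routing j → p → i and the triangle inequality give
--   cost(x′) ≤ cost(x) + Σ_p X_p Σ_i t i p d(i,p).
-- Since r^i_p X_p = x p i, the selected centres i take exactly the load x p i at distance d(i,p), and
-- the remaining load x p l of the unselected l goes to θ(p), the selected centre nearest to p, which
-- is no farther than φ(l): d(p,θ(p)) ≤ d(p,φ(l)) ≤ d(p,l) + d(l,φ(l)).  Hence
--   Σ_p X_p Σ_i t i p d(i,p) ≤ Σ_{p,l} x p l (d(p,l) + d(l,φ(l))) = cost(x) + cost(x^DS),
-- so cost(x′) ≤ 2 cost(x) + cost(x^DS).

open import Defs
open import Data.Nat using (ℕ; zero; suc)
open import Data.Fin using (Fin; zero; suc)
open import Data.Fin.Properties using (suc-injective)
open import Data.Bool using (Bool; true; false; if_then_else_)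
open import Data.Product using (_×_; ∃; _,_; proj₁; proj₂)
open import Data.Rational using (ℚ; 0ℚ; 1ℚ; _+_; _*_; _-_; _<_)
open import Function using (_∘_)
open import Relation.Binary.PropositionalEquality
  using (_≡_; _≢_; refl; sym; trans; cong; cong₂; subst; subst₂; module ≡-Reasoning)
import Data.Rational as Q

module Summation where
  open import Data.Rational using (_≤_; nonNegative)
  open import Data.Rational.Properties
    using (≤-refl; +-mono-≤; +-monoʳ-≤; +-identityˡ; +-identityʳ; *-monoˡ-≤-nonNeg;
           nonNeg*nonNeg⇒nonNeg; nonNegative⁻¹; +-*-commutativeRing; module ≤-Reasoning)
  open import Algebra.Bundles using (CommutativeRing)
  open import Algebra.Properties.Semiring.Sum (CommutativeRing.semiring +-*-commutativeRing)
    using (sum; sum-cong-≗; sum-replicate-zero; ∑-distrib-+; ∑-comm; *-distribˡ-sum; *-distribʳ-sum)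
  import Data.Rational.Solver as Solver
  open Solver.+-*-Solver

  Σ≡sum : ∀ {n} (f : Fin n → ℚ) → Σ[ f ] ≡ sum f
  Σ≡sum {zero}  f = refl
  Σ≡sum {suc n} f = cong (f zero +_) (Σ≡sum (λ i → f (suc i)))

  Σ-cong : ∀ {n} {f g : Fin n → ℚ} → (∀ i → f i ≡ g i) → Σ[ f ] ≡ Σ[ g ]
  Σ-cong {f = f} {g} f≗g = trans (Σ≡sum f) (trans (sum-cong-≗ f≗g) (sym (Σ≡sum g)))

  Σ-zero : ∀ {n} {f : Fin n → ℚ} → (∀ i → f i ≡ 0ℚ) → Σ[ f ] ≡ 0ℚ
  Σ-zero {n} f≗0 = trans (Σ-cong f≗0) (trans (Σ≡sum {n} (λ _ → 0ℚ)) (sum-replicate-zero n))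

  Σ-+ : ∀ {n} (f g : Fin n → ℚ) → Σ[ (λ i → f i + g i) ] ≡ Σ[ f ] + Σ[ g ]
  Σ-+ f g = trans (Σ≡sum (λ i → f i + g i))
                  (trans (∑-distrib-+ f g) (sym (cong₂ _+_ (Σ≡sum f) (Σ≡sum g))))

  Σ-*ˡ : ∀ {n} c (f : Fin n → ℚ) → Σ[ (λ i → c * f i) ] ≡ c * Σ[ f ]
  Σ-*ˡ c f = trans (Σ≡sum (λ i → c * f i))
                   (trans (sym (*-distribˡ-sum c f)) (cong (c *_) (sym (Σ≡sum f))))

  Σ-*ʳ : ∀ {n} c (f : Fin n → ℚ) → Σ[ (λ i → f i * c) ] ≡ Σ[ f ] * c
  Σ-*ʳ c f = trans (Σ≡sum (λ i → f i * c))
                   (trans (sym (*-distribʳ-sum c f)) (cong (_* c) (sym (Σ≡sum f))))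

  Σ-comm : ∀ {m n} (f : Fin m → Fin n → ℚ) →
           Σ[ (λ i → Σ[ f i ]) ] ≡ Σ[ (λ j → Σ[ (λ i → f i j) ]) ]
  Σ-comm f = trans (ΣΣ≡sumsum f) (trans (∑-comm f) (sym (ΣΣ≡sumsum (λ j i → f i j))))
    where
    ΣΣ≡sumsum : ∀ {m n} (g : Fin m → Fin n → ℚ) → Σ[ (λ i → Σ[ g i ]) ] ≡ sum (λ i → sum (g i))
    ΣΣ≡sumsum g = trans (Σ-cong (λ i → Σ≡sum (g i))) (Σ≡sum (λ i → sum (g i)))

  Σ-partition : ∀ {n} (P : Fin n → Bool) (f : Fin n → ℚ) →
                Σ[ f ] ≡ Σ[ (λ i → if P i then f i else 0ℚ) ] + Σ[ (λ i → if P i then 0ℚ else f i) ]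
  Σ-partition P f =
    trans (Σ-cong split) (Σ-+ (λ i → if P i then f i else 0ℚ) (λ i → if P i then 0ℚ else f i))
    where
    split : ∀ i → f i ≡ (if P i then f i else 0ℚ) + (if P i then 0ℚ else f i)
    split i with P i
    ... | true  = sym (+-identityʳ (f i))
    ... | false = sym (+-identityˡ (f i))

  Σ-supported-at : ∀ {n} {f : Fin n → ℚ} a → (∀ i → i ≢ a → f i ≡ 0ℚ) → Σ[ f ] ≡ f a
  Σ-supported-at {f = f} zero f≗0 =
    trans (cong (f zero +_) (Σ-zero (λ i → f≗0 (suc i) (λ ())))) (+-identityʳ (f zero))
  Σ-supported-at {f = f} (suc a) f≗0 =
    trans (cong₂ _+_ (f≗0 zero (λ ())) (Σ-supported-at a (λ i i≢a → f≗0 (suc i) (i≢a ∘ suc-injective))))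
          (+-identityˡ (f (suc a)))

  p≤p+q : ∀ p {q} → 0ℚ ≤ q → p ≤ p + q
  p≤p+q p {q} 0≤q = subst (_≤ p + q) (+-identityʳ p) (+-monoʳ-≤ p 0≤q)

  *-nonneg : ∀ {a b} → 0ℚ ≤ a → 0ℚ ≤ b → 0ℚ ≤ a * b
  *-nonneg {a} {b} 0≤a 0≤b =
    nonNegative⁻¹ (a * b) {{nonNeg*nonNeg⇒nonNeg a {{nonNegative 0≤a}} b {{nonNegative 0≤b}}}}

  Σ-mono : ∀ {n} {f g : Fin n → ℚ} → (∀ i → f i ≤ g i) → Σ[ f ] ≤ Σ[ g ]
  Σ-mono {zero}  f≤g = ≤-refl
  Σ-mono {suc n} f≤g = +-mono-≤ (f≤g zero) (Σ-mono (λ i → f≤g (suc i)))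

  Σ-nonneg : ∀ {n} {f : Fin n → ℚ} → (∀ i → 0ℚ ≤ f i) → 0ℚ ≤ Σ[ f ]
  Σ-nonneg {n} {f} 0≤f = subst (_≤ Σ[ f ]) (Σ-zero {n} (λ _ → refl)) (Σ-mono 0≤f)

  term≤Σ : ∀ {n} {f : Fin n → ℚ} → (∀ i → 0ℚ ≤ f i) → ∀ a → f a ≤ Σ[ f ]
  term≤Σ {f = f} 0≤f zero    = p≤p+q (f zero) (Σ-nonneg (λ i → 0≤f (suc i)))
  term≤Σ {f = f} 0≤f (suc a) =
    subst (_≤ Σ[ f ]) (+-identityˡ (f (suc a))) (+-mono-≤ (0≤f zero) (term≤Σ (λ i → 0≤f (suc i)) a))

  module _ {n : ℕ} {d : Fin n → Fin n → ℚ} (metric : IsMetric d) where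
    open IsMetric metric

    Σ-via-hub : ∀ p (g w : Fin n → ℚ) → (∀ i → 0ℚ ≤ g i) → (∀ j → 0ℚ ≤ w j) →
                Σ[ (λ i → Σ[ (λ j → (g i * w j) * d i j) ]) ]
                  ≤ Σ[ (λ i → g i * d i p) ] * Σ[ w ] + Σ[ g ] * Σ[ (λ j → w j * d p j) ]
    Σ-via-hub p g w 0≤g 0≤w = begin
        Σ[ (λ i → Σ[ (λ j → (g i * w j) * d i j) ]) ]
          ≤⟨ Σ-mono (λ i → Σ-mono (λ j → detour i j)) ⟩
        Σ[ (λ i → Σ[ (λ j → (g i * w j) * (d i p + d p j)) ]) ]
          ≡⟨ Σ-cong split ⟩
        Σ[ (λ i → g i * d i p * Σ[ w ] + g i * Σ[ (λ j → w j * d p j) ]) ]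
          ≡⟨ Σ-+ (λ i → g i * d i p * Σ[ w ]) (λ i → g i * Σ[ (λ j → w j * d p j) ]) ⟩
        Σ[ (λ i → g i * d i p * Σ[ w ]) ] + Σ[ (λ i → g i * Σ[ (λ j → w j * d p j) ]) ]
          ≡⟨ cong₂ _+_ (Σ-*ʳ (Σ[ w ]) (λ i → g i * d i p)) (Σ-*ʳ (Σ[ (λ j → w j * d p j) ]) g) ⟩
        Σ[ (λ i → g i * d i p) ] * Σ[ w ] + Σ[ g ] * Σ[ (λ j → w j * d p j) ] ∎
      where
      open ≤-Reasoning
      detour : ∀ i j → (g i * w j) * d i j ≤ (g i * w j) * (d i p + d p j)
      detour i j =
        *-monoˡ-≤-nonNeg (g i * w j) {{nonNegative (*-nonneg (0≤g i) (0≤w j))}} (triangle i p j)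
      split : ∀ i → Σ[ (λ j → (g i * w j) * (d i p + d p j)) ]
                    ≡ g i * d i p * Σ[ w ] + g i * Σ[ (λ j → w j * d p j) ]
      split i =
        trans (Σ-cong (λ j → solve 4 (λ a b e f → (a :* b) :* (e :+ f) := (a :* e) :* b :+ a :* (b :* f))
                                     refl (g i) (w j) (d i p) (d p j)))
              (trans (Σ-+ (λ j → (g i * d i p) * w j) (λ j → g i * (w j * d p j)))
                     (cong₂ _+_ (Σ-*ˡ (g i * d i p) w) (Σ-*ˡ (g i) (λ j → w j * d p j))))

module Rounding {n : ℕ} (d : Fin n → Fin n → ℚ) (metric : IsMetric d)
  (x : Fin n → Fin n → ℚ) (y : Fin n → ℚ)
  (x-nonneg : ∀ i j → 0ℚ Q.≤ x i j) (assign : ∀ j → Σ[ (λ i → x i j) ] ≡ 1ℚ)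
  (C : Fin n → Bool) (φ : Fin n → Fin n) (φ-selected : ∀ j → C (φ j) ≡ true)
  (θ : Fin n → Fin n)
  (θ-nearest : ∀ p → 0ℚ < y p → C (θ p) ≡ true × (∀ i → C i ≡ true → d p (θ p) Q.≤ d p i)) where

  open import Data.Rational using (_≤_; -_; 1/_; ≢-nonZero; positive; nonNegative)
  open import Data.Rational.Properties
  open import Data.Empty using (⊥-elim)
  open import Relation.Nullary using (¬_; Dec; yes; no)
  import Data.Fin.Properties as FinP
  import Data.Rational.Solver as Solver
  open Solver.+-*-Solver
  open IsMetric metric
  open Summation

  load : Fin n → ℚ
  load p = Σ[ x p ]

  load-nonneg : ∀ p → 0ℚ ≤ load p
  load-nonneg p = Σ-nonneg (x-nonneg p)

  load≡0 : ∀ p → ¬ (0ℚ < load p) → load p ≡ 0ℚ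
  load≡0 p 0≮load = ≤-antisym (≮⇒≥ 0≮load) (load-nonneg p)

  r-scales : ∀ i p → r x i p * load p ≡ x p i
  r-scales i p with 0ℚ <? x p i
  ... | no 0≮x = trans (*-zeroˡ (load p)) (≤-antisym (x-nonneg p i) (≮⇒≥ 0≮x))
  ... | yes 0<x with Σ[ (λ l → x p l) ] ≟ 0ℚ
  ...   | yes Σx≡0 = ⊥-elim (<-irrefl refl (<-≤-trans 0<x (subst (x p i ≤_) Σx≡0 (term≤Σ (x-nonneg p) i))))
  ...   | no Σx≢0 = begin
      x p i * 1/load * load p   ≡⟨ *-assoc (x p i) 1/load (load p) ⟩
      x p i * (1/load * load p) ≡⟨ cong (x p i *_) (*-inverseˡ (load p) {{≢-nonZero Σx≢0}}) ⟩
      x p i * 1ℚ                ≡⟨ *-identityʳ (x p i) ⟩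
      x p i                     ∎
    where
    open ≡-Reasoning
    1/load : ℚ
    1/load = (1/ load p) {{≢-nonZero Σx≢0}}

  r-vanishes : ∀ i p → load p ≡ 0ℚ → r x i p ≡ 0ℚ
  r-vanishes i p Σx≡0 with 0ℚ <? x p i
  ... | no _ = refl
  ... | yes _ with Σ[ (λ l → x p l) ] ≟ 0ℚ
  ...   | yes _   = refl
  ...   | no Σx≢0 = ⊥-elim (Σx≢0 Σx≡0)

  r-nonneg : ∀ i p → 0ℚ ≤ r x i p
  r-nonneg i p with 0ℚ <? load p
  ... | yes 0<load = *-cancelʳ-≤-pos (load p) {{positive 0<load}}
                       (subst₂ _≤_ (sym (*-zeroˡ (load p))) (sym (r-scales i p)) (x-nonneg p i))
  ... | no 0≮load  = ≤-reflexive (sym (r-vanishes i p (load≡0 p 0≮load)))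

  inN-r : ∀ i p → inN x i p * r x i p ≡ r x i p
  inN-r i p with 0ℚ <? x p i
  ... | yes _ = *-identityˡ _
  ... | no _  = *-zeroˡ 0ℚ

  selectedPart unselectedPart : Fin n → Fin n → ℚ
  selectedPart p l = if C l then x p l else 0ℚ
  unselectedPart p l = if C l then 0ℚ else x p l

  selectedLoad unselectedLoad : Fin n → ℚ
  selectedLoad p = Σ[ selectedPart p ]
  unselectedLoad p = Σ[ unselectedPart p ]

  unselectedPart-nonneg : ∀ p l → 0ℚ ≤ unselectedPart p l
  unselectedPart-nonneg p l with C l
  ... | true  = ≤-refl
  ... | false = x-nonneg p l

  share : Fin n → Fin n → ℚ
  share i p = if C i then r x i p else 0ℚ

  selectedShare : Fin n → ℚ
  selectedShare p = Σ[ (λ i → share i p) ]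

  share-scales : ∀ i p → share i p * load p ≡ selectedPart p i
  share-scales i p with C i
  ... | true  = r-scales i p
  ... | false = *-zeroˡ (load p)

  share-nonneg : ∀ i p → 0ℚ ≤ share i p
  share-nonneg i p with C i
  ... | true  = r-nonneg i p
  ... | false = ≤-refl

  selectedShare-scales : ∀ p → selectedShare p * load p ≡ selectedLoad p
  selectedShare-scales p =
    trans (sym (Σ-*ʳ (load p) (λ i → share i p))) (Σ-cong (λ i → share-scales i p))

  unselectedShare-scales : ∀ p → (1ℚ - selectedShare p) * load p ≡ unselectedLoad p
  unselectedShare-scales p = begin
      (1ℚ - selectedShare p) * load p
        ≡⟨ solve 2 (λ s l → (con 1ℚ :- s) :* l := l :- s :* l) refl (selectedShare p) (load p) ⟩
      load p - selectedShare p * load p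
        ≡⟨ cong₂ _-_ (Σ-partition C (x p)) (selectedShare-scales p) ⟩
      (selectedLoad p + unselectedLoad p) - selectedLoad p
        ≡⟨ solve 2 (λ a b → (a :+ b) :- a := b) refl (selectedLoad p) (unselectedLoad p) ⟩
      unselectedLoad p ∎
    where open ≡-Reasoning

  selectedShare≤1 : ∀ p → selectedShare p ≤ 1ℚ
  selectedShare≤1 p with 0ℚ <? load p
  ... | yes 0<load = *-cancelʳ-≤-pos (load p) {{positive 0<load}} (begin
      selectedShare p * load p           ≡⟨ selectedShare-scales p ⟩
      selectedLoad p                     ≤⟨ p≤p+q (selectedLoad p) (Σ-nonneg (unselectedPart-nonneg p)) ⟩
      selectedLoad p + unselectedLoad p  ≡⟨ Σ-partition C (x p) ⟨
      load p                             ≡⟨ *-identityˡ (load p) ⟨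
      1ℚ * load p                        ∎)
    where open ≤-Reasoning
  ... | no 0≮load = subst (_≤ 1ℚ) (sym (Σ-zero share-vanishes)) (nonNegative⁻¹ 1ℚ)
    where
    share-vanishes : ∀ i → share i p ≡ 0ℚ
    share-vanishes i with C i
    ... | true  = r-vanishes i p (load≡0 p 0≮load)
    ... | false = refl

  toθ : Fin n → Fin n → ℚ
  toθ i p = if C i then inθ⁻¹ y θ i p else 0ℚ

  toθ-nonneg : ∀ i p → 0ℚ ≤ toθ i p
  toθ-nonneg i p with C i
  ... | false = ≤-refl
  ... | true with 0ℚ <? y p | θ p FinP.≟ i
  ...   | yes _ | yes _ = nonNegative⁻¹ 1ℚ
  ...   | yes _ | no _  = ≤-refl
  ...   | no _  | _     = ≤-refl

  Σ-toθ-pos : ∀ p (f : Fin n → ℚ) → 0ℚ < y p → Σ[ (λ i → toθ i p * f i) ] ≡ f (θ p)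
  Σ-toθ-pos p f 0<y = trans (Σ-supported-at (θ p) elsewhere) at-θ
    where
    elsewhere : ∀ i → i ≢ θ p → toθ i p * f i ≡ 0ℚ
    elsewhere i i≢θp with C i | 0ℚ <? y p | θ p FinP.≟ i
    ... | false | _     | _        = *-zeroˡ (f i)
    ... | true  | yes _ | yes θp≡i = ⊥-elim (i≢θp (sym θp≡i))
    ... | true  | yes _ | no _     = *-zeroˡ (f i)
    ... | true  | no _  | _        = *-zeroˡ (f i)
    at-θ : toθ (θ p) p * f (θ p) ≡ f (θ p)
    at-θ rewrite proj₁ (θ-nearest p 0<y) with 0ℚ <? y p | θ p FinP.≟ θ p
    ... | yes _  | yes _    = *-identityˡ (f (θ p))
    ... | yes _  | no θp≢θp = ⊥-elim (θp≢θp refl)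
    ... | no 0≮y | _        = ⊥-elim (0≮y 0<y)

  Σ-toθ-nonpos : ∀ p (f : Fin n → ℚ) → ¬ (0ℚ < y p) → Σ[ (λ i → toθ i p * f i) ] ≡ 0ℚ
  Σ-toθ-nonpos p f 0≮y = Σ-zero vanishes
    where
    vanishes : ∀ i → toθ i p * f i ≡ 0ℚ
    vanishes i with C i | 0ℚ <? y p
    ... | false | _       = *-zeroˡ (f i)
    ... | true  | yes 0<y = ⊥-elim (0≮y 0<y)
    ... | true  | no _    = *-zeroˡ (f i)

  transfer : Fin n → Fin n → ℚ
  transfer i p = share i p + toθ i p * (1ℚ - selectedShare p)

  x′-as-transfer : ∀ i j → x′ C θ x y i j ≡ Σ[ (λ p → transfer i p * x p j) ]
  x′-as-transfer i j with C i
  ... | true  = trans (sym (Σ-+ (λ p → inN x i p * (r x i p * x p j))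
                                (λ p → inθ⁻¹ y θ i p * ((1ℚ - selectedShare p) * x p j))))
                      (Σ-cong pointwise)
    where
    pointwise : ∀ p → inN x i p * (r x i p * x p j) + inθ⁻¹ y θ i p * ((1ℚ - selectedShare p) * x p j)
                      ≡ (r x i p + inθ⁻¹ y θ i p * (1ℚ - selectedShare p)) * x p j
    pointwise p =
      trans (cong (_+ inθ⁻¹ y θ i p * ((1ℚ - selectedShare p) * x p j))
                  (trans (sym (*-assoc (inN x i p) (r x i p) (x p j))) (cong (_* x p j) (inN-r i p))))
            (solve 4 (λ a t s v → a :* v :+ t :* ((con 1ℚ :- s) :* v) := (a :+ t :* (con 1ℚ :- s)) :* v)
                   refl (r x i p) (inθ⁻¹ y θ i p) (selectedShare p) (x p j))
  ... | false = sym (Σ-zero (λ p → solve 2 (λ s v → (con 0ℚ :+ con 0ℚ :* (con 1ℚ :- s)) :* v := con 0ℚ)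
                                          refl (selectedShare p) (x p j)))

  transfer-nonneg : ∀ i p → 0ℚ ≤ transfer i p
  transfer-nonneg i p = +-mono-≤ (share-nonneg i p) (*-nonneg (toθ-nonneg i p) 0≤1-selectedShare)
    where
    0≤1-selectedShare : 0ℚ ≤ 1ℚ - selectedShare p
    0≤1-selectedShare = subst (_≤ 1ℚ - selectedShare p) (+-inverseʳ (selectedShare p))
                              (+-monoˡ-≤ (- selectedShare p) (selectedShare≤1 p))

  Σ-transfer≤1 : ∀ p → Σ[ (λ i → transfer i p) ] ≤ 1ℚ
  Σ-transfer≤1 p =
    subst (_≤ 1ℚ) (sym (Σ-+ (λ i → share i p) (λ i → toθ i p * (1ℚ - S)))) (by-cases (0ℚ <? y p))
    where
    S : ℚ
    S = selectedShare p
    -- a case split by `with` would also abstract the test 0ℚ <? y p hidden inside toθ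
    by-cases : Dec (0ℚ < y p) → S + Σ[ (λ i → toθ i p * (1ℚ - S)) ] ≤ 1ℚ
    by-cases (yes 0<y) = ≤-reflexive (trans (cong (S +_) (Σ-toθ-pos p (λ _ → 1ℚ - S) 0<y))
                                           (solve 1 (λ s → s :+ (con 1ℚ :- s) := con 1ℚ) refl S))
    by-cases (no 0≮y)  = subst (_≤ 1ℚ) (sym (trans (cong (S +_) (Σ-toθ-nonpos p (λ _ → 1ℚ - S) 0≮y))
                                                   (+-identityʳ S)))
                               (selectedShare≤1 p)

  dφ : Fin n → ℚ
  dφ l = d l (φ l)

  θ-no-farther-than-φ : ∀ p → 0ℚ < y p → ∀ l → d (θ p) p ≤ d p l + dφ l
  θ-no-farther-than-φ p 0<y l = begin
      d (θ p) p     ≡⟨ symmetric (θ p) p ⟩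
      d p (θ p)     ≤⟨ proj₂ (θ-nearest p 0<y) (φ l) (φ-selected l) ⟩
      d p (φ l)     ≤⟨ triangle p l (φ l) ⟩
      d p l + dφ l  ∎
    where open ≤-Reasoning

  toθ-distance : ∀ p → Σ[ (λ i → toθ i p * (unselectedLoad p * d i p)) ]
                         ≤ Σ[ (λ l → unselectedPart p l * (d p l + dφ l)) ]
  toθ-distance p = by-cases (0ℚ <? y p)
    where
    open ≤-Reasoning
    by-cases : Dec (0ℚ < y p) → Σ[ (λ i → toθ i p * (unselectedLoad p * d i p)) ]
                                  ≤ Σ[ (λ l → unselectedPart p l * (d p l + dφ l)) ]
    by-cases (yes 0<y) = begin
      Σ[ (λ i → toθ i p * (unselectedLoad p * d i p)) ]
        ≡⟨ Σ-toθ-pos p (λ i → unselectedLoad p * d i p) 0<y ⟩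
      unselectedLoad p * d (θ p) p
        ≡⟨ Σ-*ʳ (d (θ p) p) (unselectedPart p) ⟨
      Σ[ (λ l → unselectedPart p l * d (θ p) p) ]
        ≤⟨ Σ-mono (λ l → *-monoˡ-≤-nonNeg (unselectedPart p l) {{nonNegative (unselectedPart-nonneg p l)}}
                                          (θ-no-farther-than-φ p 0<y l)) ⟩
      Σ[ (λ l → unselectedPart p l * (d p l + dφ l)) ] ∎
    by-cases (no 0≮y) = begin
      Σ[ (λ i → toθ i p * (unselectedLoad p * d i p)) ]
        ≡⟨ Σ-toθ-nonpos p (λ i → unselectedLoad p * d i p) 0≮y ⟩
      0ℚ
        ≤⟨ Σ-nonneg (λ l → *-nonneg (unselectedPart-nonneg p l) (+-mono-≤ (nonneg p l) (nonneg l (φ l)))) ⟩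
      Σ[ (λ l → unselectedPart p l * (d p l + dφ l)) ] ∎

  viaφCost : Fin n → ℚ
  viaφCost p = Σ[ (λ l → x p l * (d p l + dφ l)) ]

  transfer-distance : ∀ p → Σ[ (λ i → transfer i p * d i p) ] * load p ≤ viaφCost p
  transfer-distance p = begin
      Σ[ (λ i → transfer i p * d i p) ] * load p
        ≡⟨ Σ-*ʳ (load p) (λ i → transfer i p * d i p) ⟨
      Σ[ (λ i → transfer i p * d i p * load p) ]
        ≡⟨ Σ-cong rescale ⟩
      Σ[ (λ i → selectedPart p i * d i p + toθ i p * (unselectedLoad p * d i p)) ]
        ≡⟨ Σ-+ (λ i → selectedPart p i * d i p) (λ i → toθ i p * (unselectedLoad p * d i p)) ⟩
      Σ[ (λ i → selectedPart p i * d i p) ] + Σ[ (λ i → toθ i p * (unselectedLoad p * d i p)) ]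
        ≤⟨ +-monoʳ-≤ (Σ[ (λ i → selectedPart p i * d i p) ]) (toθ-distance p) ⟩
      Σ[ (λ l → selectedPart p l * d l p) ] + Σ[ (λ l → unselectedPart p l * (d p l + dφ l)) ]
        ≡⟨ Σ-+ (λ l → selectedPart p l * d l p) (λ l → unselectedPart p l * (d p l + dφ l)) ⟨
      Σ[ (λ l → selectedPart p l * d l p + unselectedPart p l * (d p l + dφ l)) ]
        ≤⟨ Σ-mono recombine ⟩
      viaφCost p ∎
    where
    open ≤-Reasoning
    rescale : ∀ i → transfer i p * d i p * load p
                    ≡ selectedPart p i * d i p + toθ i p * (unselectedLoad p * d i p)
    rescale i =
      trans (solve 5 (λ a t s e l → (a :+ t :* (con 1ℚ :- s)) :* e :* l
                                      := (a :* l) :* e :+ t :* (((con 1ℚ :- s) :* l) :* e))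
                   refl (share i p) (toθ i p) (selectedShare p) (d i p) (load p))
            (cong₂ (λ a u → a * d i p + toθ i p * (u * d i p)) (share-scales i p) (unselectedShare-scales p))
    recombine : ∀ l → selectedPart p l * d l p + unselectedPart p l * (d p l + dφ l)
                      ≤ x p l * (d p l + dφ l)
    recombine l with C l
    ... | true  = begin
      x p l * d l p + 0ℚ * (d p l + dφ l)
        ≡⟨ solve 3 (λ a e f → a :* e :+ con 0ℚ :* f := a :* e) refl (x p l) (d l p) (d p l + dφ l) ⟩
      x p l * d l p
        ≡⟨ cong (x p l *_) (symmetric l p) ⟩
      x p l * d p l
        ≤⟨ *-monoˡ-≤-nonNeg (x p l) {{nonNegative (x-nonneg p l)}} (p≤p+q (d p l) (nonneg l (φ l))) ⟩
      x p l * (d p l + dφ l) ∎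
    ... | false = ≤-reflexive (solve 3 (λ e a f → con 0ℚ :* e :+ a :* f := a :* f)
                                       refl (d l p) (x p l) (d p l + dφ l))

  serviceCost : Fin n → ℚ
  serviceCost p = Σ[ (λ j → x p j * d p j) ]

  rerouted-cost : ∀ p → Σ[ (λ i → Σ[ (λ j → (transfer i p * x p j) * d i j) ]) ]
                          ≤ serviceCost p + viaφCost p
  rerouted-cost p = begin
      Σ[ (λ i → Σ[ (λ j → (transfer i p * x p j) * d i j) ]) ]
        ≤⟨ Σ-via-hub metric p (λ i → transfer i p) (x p) (λ i → transfer-nonneg i p) (x-nonneg p) ⟩
      Σ[ (λ i → transfer i p * d i p) ] * load p + Σ[ (λ i → transfer i p) ] * serviceCost p
        ≤⟨ +-mono-≤ (transfer-distance p)
                    (*-monoʳ-≤-nonNeg (serviceCost p) {{nonNegative serviceCost-nonneg}} (Σ-transfer≤1 p)) ⟩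
      viaφCost p + 1ℚ * serviceCost p
        ≡⟨ solve 2 (λ v s → v :+ con 1ℚ :* s := s :+ v) refl (viaφCost p) (serviceCost p) ⟩
      serviceCost p + viaφCost p ∎
    where
    open ≤-Reasoning
    serviceCost-nonneg : 0ℚ ≤ serviceCost p
    serviceCost-nonneg = Σ-nonneg (λ j → *-nonneg (x-nonneg p j) (nonneg p j))

  cost-x′-by-source : cost d (x′ C θ x y) (y′ C)
                        ≡ Σ[ (λ p → Σ[ (λ i → Σ[ (λ j → (transfer i p * x p j) * d i j) ]) ]) ]
  cost-x′-by-source = begin
      cost d (x′ C θ x y) (y′ C)
        ≡⟨ Σ-cong (λ i → Σ-cong (λ j → trans (cong (_* d i j) (x′-as-transfer i j))
                                              (sym (Σ-*ʳ (d i j) (λ p → transfer i p * x p j))))) ⟩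
      Σ[ (λ i → Σ[ (λ j → Σ[ (λ p → rerouted i j p) ]) ]) ]
        ≡⟨ Σ-cong (λ i → Σ-comm (rerouted i)) ⟩
      Σ[ (λ i → Σ[ (λ p → Σ[ (λ j → rerouted i j p) ]) ]) ]
        ≡⟨ Σ-comm (λ i p → Σ[ (λ j → rerouted i j p) ]) ⟩
      Σ[ (λ p → Σ[ (λ i → Σ[ (λ j → rerouted i j p) ]) ]) ] ∎
    where
    open ≡-Reasoning
    rerouted : Fin n → Fin n → Fin n → ℚ
    rerouted i j p = (transfer i p * x p j) * d i j

  Σ-viaφCost : Σ[ viaφCost ] ≡ cost d x y + Σ[ dφ ]
  Σ-viaφCost = begin
      Σ[ viaφCost ]
        ≡⟨ Σ-cong (λ p → trans (Σ-cong (λ l → *-distribˡ-+ (x p l) (d p l) (dφ l)))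
                               (Σ-+ (λ l → x p l * d p l) (λ l → x p l * dφ l))) ⟩
      Σ[ (λ p → serviceCost p + Σ[ (λ l → x p l * dφ l) ]) ]
        ≡⟨ Σ-+ serviceCost (λ p → Σ[ (λ l → x p l * dφ l) ]) ⟩
      cost d x y + Σ[ (λ p → Σ[ (λ l → x p l * dφ l) ]) ]
        ≡⟨ cong (cost d x y +_) (Σ-comm (λ p l → x p l * dφ l)) ⟩
      cost d x y + Σ[ (λ l → Σ[ (λ p → x p l * dφ l) ]) ]
        ≡⟨ cong (cost d x y +_) (Σ-cong served-once) ⟩
      cost d x y + Σ[ dφ ] ∎
    where
    open ≡-Reasoning
    served-once : ∀ l → Σ[ (λ p → x p l * dφ l) ] ≡ dφ l
    served-once l = trans (Σ-*ʳ (dφ l) (λ p → x p l)) (trans (cong (_* dφ l) (assign l)) (*-identityˡ (dφ l)))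

  cost-xDS : cost d (xDS φ) (yDS C) ≡ Σ[ dφ ]
  cost-xDS = trans (Σ-comm (λ i j → xDS φ i j * d i j))
                   (Σ-cong (λ j → trans (Σ-supported-at (φ j) (elsewhere j)) (at-φ j)))
    where
    elsewhere : ∀ j i → i ≢ φ j → xDS φ i j * d i j ≡ 0ℚ
    elsewhere j i i≢φj with φ j FinP.≟ i
    ... | yes φj≡i = ⊥-elim (i≢φj (sym φj≡i))
    ... | no _     = *-zeroˡ (d i j)
    at-φ : ∀ j → xDS φ (φ j) j * d (φ j) j ≡ dφ j
    at-φ j with φ j FinP.≟ φ j
    ... | yes _    = trans (*-identityˡ (d (φ j) j)) (symmetric (φ j) j)
    ... | no φj≢φj = ⊥-elim (φj≢φj refl)

  cost-bound : cost d (x′ C θ x y) (y′ C) ≤ ℕ→ℚ 3 * cost d x y + cost d (xDS φ) (yDS C)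
  cost-bound = begin
      cost d (x′ C θ x y) (y′ C)
        ≡⟨ cost-x′-by-source ⟩
      Σ[ (λ p → Σ[ (λ i → Σ[ (λ j → (transfer i p * x p j) * d i j) ]) ]) ]
        ≤⟨ Σ-mono rerouted-cost ⟩
      Σ[ (λ p → serviceCost p + viaφCost p) ]
        ≡⟨ trans (Σ-+ serviceCost viaφCost) (cong (c +_) Σ-viaφCost) ⟩
      c + (c + Σ[ dφ ])
        ≤⟨ p≤p+q (c + (c + Σ[ dφ ])) (Σ-nonneg (λ i → Σ-nonneg (λ j → *-nonneg (x-nonneg i j) (nonneg i j)))) ⟩
      c + (c + Σ[ dφ ]) + c
        ≡⟨ solve 2 (λ a e → a :+ (a :+ e) :+ a := con (ℕ→ℚ 3) :* a :+ e) refl c (Σ[ dφ ]) ⟩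
      ℕ→ℚ 3 * c + Σ[ dφ ]
        ≡⟨ cong (ℕ→ℚ 3 * c +_) cost-xDS ⟨
      ℕ→ℚ 3 * c + cost d (xDS φ) (yDS C) ∎
    where
    open ≤-Reasoning
    c : ℚ
    c = cost d x y

open import Data.Nat using (_≤_)

lemma13 : (n m k : ℕ) (d : Fin n → Fin n → ℚ) → IsMetric d →
          1 ≤ k → k ≤ n →
          (col : Fin n → Fin m) → (∀ h → ∃ λ p → col p ≡ h) →
          (ℓ u : Fin m → ℚ) → (∀ h → 0ℚ Q.≤ ℓ h × ℓ h Q.≤ u h × u h Q.≤ 1ℚ) →
          (x : Fin n → Fin n → ℚ) (y : Fin n → ℚ) → LPOptimal k col ℓ u d x y →
          (C : Fin n → Bool) (φ : Fin n → Fin n) →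
          count C ≤ k → (∀ j → C (φ j) ≡ true) →
          (θ : Fin n → Fin n) →
          (∀ p → 0ℚ < y p →
             C (θ p) ≡ true × (∀ i → C i ≡ true → d p (θ p) Q.≤ d p i)) →
          cost d (x′ C θ x y) (y′ C)
            Q.≤ ℕ→ℚ 3 * cost d x y + cost d (xDS φ) (yDS C)
lemma13 _ _ _ d metric _ _ _ _ _ _ _ x y (feasible , _) C φ _ φ-selected θ θ-nearest =
  Rounding.cost-bound d metric x y
    (λ i j → proj₁ (LPFeasible.x-bounds feasible i j)) (LPFeasible.assign feasible)
    C φ φ-selected θ θ-nearest
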